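{- For all integers $n \ge 1$ and $v \ge 1$, \[ \kappa(n,v) = \lfloor \log_{v+1}(n v + 1) \rfloor. \]
   Context: All graphs are finite and simple. An interval graph is the intersection graph of a finite family of open intervals of the real line. The claw number of a graph $G$ is the largest integer $v \ge 0$ such that the star $K_{1,v}$ is an induced subgraph of $G$. For $n \ge 1$ and $v \ge 1$, $\kappa(n,v)$ denotes the smallest integer $k$ such that every interval graph with $n$ vertices admits a partition of its vertex set into $k$ subsets each inducing a subgraph with claw number at most $v$.
   Formalization: Interval graphs are taken as intersection graphs of open intervals with rational endpoints that meet at rational points, rather than open intervals of the real line. -}

module Defs where

open import Data.Nat using (ℕ; suc; _+_; _*_; _^_; _≤_; _<_)
open import Data.Fin using (Fin)
open import Data.Rational using (ℚ) renaming (_<_ to _<ℚ_)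
open import Data.Product using (Σ; _×_; ∃)
open import Function.Definitions using (Injective)
open import Relation.Binary.PropositionalEquality using (_≡_)
open import Relation.Nullary using (¬_)

record Interval : Set where
  constructor interval
  field
    left  : ℚ
    right : ℚ
    nonempty : left <ℚ right
open Interval public

_∈I_ : ℚ → Interval → Set
x ∈I I = (left I <ℚ x) × (x <ℚ right I)

Meet : Interval → Interval → Set
Meet I J = ∃ λ x → (x ∈I I) × (x ∈I J)

Adj : ∀ {n} → (Fin n → Interval) → Fin n → Fin n → Set
Adj I u w = ¬ (u ≡ w) × Meet (I u) (I w)

HasInducedStar : ∀ {n} → (Fin n → Interval) → (Fin n → Set) → ℕ → Set
HasInducedStar {n} I S m =
  Σ (Fin n) λ c → Σ (Fin m → Fin n) λ leaf →
    S c × Injective _≡_ _≡_ leaf ×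
    (∀ i → S (leaf i)) ×
    (∀ i → Adj I c (leaf i)) ×
    (∀ i j → ¬ (i ≡ j) → ¬ Adj I (leaf i) (leaf j))

ClawNumberAtMost : ∀ {n} → (Fin n → Interval) → (Fin n → Set) → ℕ → Set
ClawNumberAtMost I S v = ∀ m → HasInducedStar I S m → m ≤ v

Partitionable : ℕ → ℕ → ℕ → Set
Partitionable n v k =
  (I : Fin n → Interval) →
    Σ (Fin n → Fin k) λ part →
      ∀ (j : Fin k) → ClawNumberAtMost I (λ u → part u ≡ j) v

IsKappa : ℕ → ℕ → ℕ → Set
IsKappa n v k = Partitionable n v k × (∀ j → Partitionable n v j → k ≤ j)

IsFloorLog : ℕ → ℕ → ℕ → Set
IsFloorLog b x L = (b ^ L ≤ x) × (x < b ^ suc L)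

-- Write N(k) = 1 + (v+1) + ⋯ + (v+1)^k. Since N(k)·v + 1 = (v+1)^(k+1), it is enough to show
-- that k classes suffice for all interval graphs on n vertices exactly when n < N(k).
--
-- Sufficiency, by induction on k. Let n ≤ (v+1)·M with M = N(k−1), and sweep from left to right.
-- While at least M intervals remain, choose a point t such that fewer than M of them end before t
-- but at least M end by t; the intervals ending before t get k−1 colours recursively, those
-- containing t form a clique that joins the new class, and the sweep continues with those starting
-- after t. The last fewer than M intervals also get k−1 colours; the groups coloured recursively
-- never meet each other. Every cut removes at least M intervals, so the number c of cuts satisfies
-- c·M ≤ n. If c ≤ v, the new class is covered by v cliques and has no induced K_{1,v+1} by
-- pigeonhole. Otherwise c = v + 1 and c·M = n, so every cut removed exactly M intervals: no interval
-- of a clique extends past its cut point, and the new class is a disjoint union of cliques, which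
-- has no induced K_{1,2}.
--
-- Necessity. The configuration of depth d + 1 is one long interval containing v + 1 disjoint copies
-- of the configuration of depth d; it has N(d+1) intervals. Some copy avoids the colour of the long
-- interval, for otherwise that interval together with one interval of its colour from each copy
-- would induce a K_{1,v+1}. By induction this copy already needs d + 1 other colours.

module Submission where

open import Defs
open import Data.Nat using (ℕ; _+_; _*_; _≤_)
open import Data.Nat as ℕ using (zero; suc; z≤n; s≤s; _<_; _^_)
import Data.Nat.Properties as ℕP
open import Data.Nat.Induction using (<-wellFounded)
open import Data.Nat.Tactic.RingSolver using (solve-∀)
import Data.Nat.Coprimality as Coprimality
import Data.Integer as ℤ
import Data.Integer.Properties as ℤP
open import Data.Rational as ℚ using (ℚ; mkℚ)
import Data.Rational.Properties as ℚP
open import Data.Fin as Fin using (Fin)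
import Data.Fin.Properties as FinP
open import Data.Bool using (if_then_else_)
open import Data.Unit using (⊤; tt)
open import Data.Product using (Σ; _×_; _,_; proj₁; proj₂; ∃; uncurry)
open import Data.Sum using (_⊎_; inj₁; inj₂; [_,_]′)
open import Data.List using (List; []; _∷_; _++_; length; filter; allFin)
import Data.List.Properties as ListP
open import Data.List.Membership.Propositional using (_∈_; find; lose)
open import Data.List.Membership.Propositional.Properties
  using (∈-++⁻; ∈-++⁺ˡ; ∈-++⁺ʳ; ∈-filter⁺; ∈-filter⁻; ∈-allFin)
open import Data.List.Relation.Binary.Subset.Propositional using (_⊆_)
open import Data.List.Relation.Binary.Subset.Propositional.Properties using (filter-⊆)
open import Data.List.Relation.Unary.Any using (Any; here; there; any?)
open import Data.List.Relation.Unary.All as All using (All)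
open import Relation.Binary.Bundles using (DecTotalOrder)
open import Data.List.Extrema (DecTotalOrder.totalOrder ℚP.≤-decTotalOrder)
  using (argmax; argmax-all; f[⊥]≤f[argmax]; f[xs]≤f[argmax])
open import Function using (_∘_; id)
open import Function.Definitions using (Injective)
open import Induction.WellFounded using (Acc; acc)
open import Relation.Binary.Definitions using (tri<; tri≈; tri>)
open import Relation.Binary.PropositionalEquality
  using (_≡_; _≢_; refl; sym; trans; cong; subst; subst₂; module ≡-Reasoning)
open import Relation.Nullary using (¬_; Dec; yes; no; does; contradiction; _×-dec_)
open import Relation.Unary using (Pred; Decidable)
open import Relation.Unary.Properties using (∁?)

Meet-sym : ∀ {a b} → Meet a b → Meet b a
Meet-sym (x , x∈a , x∈b) = x , x∈b , x∈a

right≤left⇒¬Meet : ∀ {a b} → right a ℚ.≤ left b → ¬ Meet a b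
right≤left⇒¬Meet ra≤lb (x , (_ , x<ra) , (lb<x , _)) =
  ℚP.<-irrefl refl (ℚP.<-trans x<ra (ℚP.≤-<-trans ra≤lb lb<x))

left≤-overlap⇒Meet : ∀ {a b} → left a ℚ.≤ left b → left b ℚ.< right a → Meet a b
left≤-overlap⇒Meet {a} {b} la≤lb lb<ra with ℚP.≤-total (right a) (right b)
... | inj₁ ra≤rb = let x , lb<x , x<ra = ℚP.<-dense lb<ra in
  x , (ℚP.≤-<-trans la≤lb lb<x , x<ra) , (lb<x , ℚP.<-≤-trans x<ra ra≤rb)
... | inj₂ rb≤ra = let x , lb<x , x<rb = ℚP.<-dense (nonempty b) in
  x , (ℚP.≤-<-trans la≤lb lb<x , ℚP.<-≤-trans x<rb rb≤ra) , (lb<x , x<rb)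

overlap⇒Meet : ∀ {a b} → left a ℚ.< right b → left b ℚ.< right a → Meet a b
overlap⇒Meet {a} {b} la<rb lb<ra with ℚP.≤-total (left a) (left b)
... | inj₁ la≤lb = left≤-overlap⇒Meet {a} {b} la≤lb lb<ra
... | inj₂ lb≤la = Meet-sym {b} {a} (left≤-overlap⇒Meet {b} {a} lb≤la la<rb)

toℚ : ℕ → ℚ
toℚ m = mkℚ (ℤ.+ m) 0 (Coprimality.sym (Coprimality.1-coprimeTo m))

toℚ-mono-< : ∀ {a b} → a < b → toℚ a ℚ.< toℚ b
toℚ-mono-< {a} {b} a<b =
  ℚ.*<* (subst₂ ℤ._<_ (sym (ℤP.*-identityʳ (ℤ.+ a))) (sym (ℤP.*-identityʳ (ℤ.+ b))) (ℤ.+<+ a<b))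

toℚ-mono-≤ : ∀ {a b} → a ≤ b → toℚ a ℚ.≤ toℚ b
toℚ-mono-≤ {a} {b} a≤b =
  ℚ.*≤* (subst₂ ℤ._≤_ (sym (ℤP.*-identityʳ (ℤ.+ a))) (sym (ℤP.*-identityʳ (ℤ.+ b))) (ℤ.+≤+ a≤b))

StarFree : ∀ {n} → (Fin n → Interval) → (Fin n → Set) → ℕ → Set
StarFree I S v = ¬ HasInducedStar I S (suc v)

module Stars {n} (I : Fin n → Interval) where

  restrictStar : ∀ {S T : Fin n → Set} {m} (star : HasInducedStar I S m) →
                 T (proj₁ star) →
                 (∀ {u} → S u → Meet (I (proj₁ star)) (I u) → T u) →
                 HasInducedStar I T m
  restrictStar (c , leaf , _ , leaf-inj , leaf∈S , adj , nonadj) c∈T S∩N⊆T =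
    c , leaf , c∈T , leaf-inj , (λ i → S∩N⊆T (leaf∈S i) (proj₂ (adj i))) , adj , nonadj

  starFree-⊆ : ∀ {S T : Fin n → Set} {v} → (∀ {u} → S u → T u) →
               StarFree I T v → StarFree I S v
  starFree-⊆ S⊆T free star@(_ , _ , c∈S , _) = free (restrictStar star (S⊆T c∈S) (λ u∈S _ → S⊆T u∈S))

  shrinkStar : ∀ {S} {m m′ : ℕ} → m ≤ m′ → HasInducedStar I S m′ → HasInducedStar I S m
  shrinkStar {m = m} {m′} m≤m′ (c , leaf , c∈S , leaf-inj , leaf∈S , adj , nonadj) =
    c , leaf ∘ embed , c∈S , (λ eq → FinP.inject≤-injective m≤m′ m≤m′ _ _ (leaf-inj eq)) ,
    leaf∈S ∘ embed , adj ∘ embed ,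
    (λ i j i≢j → nonadj (embed i) (embed j) (i≢j ∘ FinP.inject≤-injective m≤m′ m≤m′ i j))
    where
    embed : Fin m → Fin m′
    embed i = Fin.inject≤ i m≤m′

  starFree⇒clawNumberAtMost : ∀ {S v} → StarFree I S v → ClawNumberAtMost I S v
  starFree⇒clawNumberAtMost {v = v} free m star with m ℕP.≤? v
  ... | yes m≤v = m≤v
  ... | no m≰v = contradiction (shrinkStar (ℕP.≰⇒> m≰v) star) free

  clawNumberAtMost⇒starFree : ∀ {S v} → ClawNumberAtMost I S v → StarFree I S v
  clawNumberAtMost⇒starFree atMost star = ℕP.1+n≰n (atMost _ star)

  fewCliques⇒starFree : ∀ {S : Fin n → Set} {v} (index : Fin n → ℕ) →
                        (∀ {u} → S u → index u < v) →
                        (∀ {u w} → S u → S w → index u ≡ index w → Meet (I u) (I w)) →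
                        StarFree I S v
  fewCliques⇒starFree {v = v} index index<v clique (_ , leaf , _ , leaf-inj , leaf∈S , _ , nonadj)
    with FinP.pigeonhole (ℕP.n<1+n v) (λ i → Fin.fromℕ< (index<v (leaf∈S i)))
  ... | i , i′ , i<i′ , same =
    nonadj i i′ i≢i′
      (i≢i′ ∘ leaf-inj , clique (leaf∈S i) (leaf∈S i′) (FinP.fromℕ<-injective _ _ _ _ same))
    where
    i≢i′ : i ≢ i′
    i≢i′ = FinP.<⇒≢ i<i′

  clusters⇒starFree : ∀ {S : Fin n → Set} {v} (index : Fin n → ℕ) → 1 ≤ v →
                      (∀ {u w} → S u → S w → index u ≡ index w → Meet (I u) (I w)) →
                      (∀ {u w} → S u → S w → Meet (I u) (I w) → index u ≡ index w) →
                      StarFree I S v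
  clusters⇒starFree index 1≤v clique cluster star with shrinkStar (s≤s 1≤v) star
  ... | c , leaf , c∈S , leaf-inj , leaf∈S , adj , nonadj =
    nonadj Fin.zero one (λ ())
      ((λ eq → contradiction (leaf-inj eq) λ ()) ,
       clique (leaf∈S Fin.zero) (leaf∈S one) (trans (sym (sameAsCentre Fin.zero)) (sameAsCentre one)))
    where
    one : Fin 2
    one = Fin.suc Fin.zero
    sameAsCentre : ∀ i → index c ≡ index (leaf i)
    sameAsCentre i = cluster c∈S (leaf∈S i) (proj₂ (adj i))

module _ {a p q} {A : Set a} {P : Pred A p} {Q : Pred A q} (P? : Decidable P) (Q? : Decidable Q) where

  length-filter-mono : ∀ {xs} → (∀ {x} → x ∈ xs → P x → Q x) →
                       length (filter P? xs) ≤ length (filter Q? xs)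
  length-filter-mono {[]} _ = z≤n
  length-filter-mono {x ∷ xs} P⇒Q with P? x | Q? x
  ... | yes _  | yes _  = s≤s (length-filter-mono (P⇒Q ∘ there))
  ... | yes px | no ¬qx = contradiction (P⇒Q (here refl) px) ¬qx
  ... | no _   | yes _  = ℕP.m≤n⇒m≤1+n (length-filter-mono (P⇒Q ∘ there))
  ... | no _   | no _   = length-filter-mono (P⇒Q ∘ there)

  length-filter-mono-< : ∀ {xs y} → (∀ {x} → x ∈ xs → P x → Q x) →
                         y ∈ xs → Q y → ¬ P y →
                         length (filter P? xs) < length (filter Q? xs)
  length-filter-mono-< {x ∷ xs} P⇒Q (here refl) qy ¬py with P? x | Q? x
  ... | yes py | _      = contradiction py ¬py
  ... | no _   | yes _  = s≤s (length-filter-mono (P⇒Q ∘ there))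
  ... | no _   | no ¬qy = contradiction qy ¬qy
  length-filter-mono-< {x ∷ xs} P⇒Q (there y∈xs) qy ¬py with P? x | Q? x
  ... | yes _  | yes _  = s≤s (length-filter-mono-< (P⇒Q ∘ there) y∈xs qy ¬py)
  ... | yes px | no ¬qx = contradiction (P⇒Q (here refl) px) ¬qx
  ... | no _   | yes _  = ℕP.m<n⇒m<1+n (length-filter-mono-< (P⇒Q ∘ there) y∈xs qy ¬py)
  ... | no _   | no _   = length-filter-mono-< (P⇒Q ∘ there) y∈xs qy ¬py

module _ {a p} {A : Set a} {P : Pred A p} (P? : Decidable P) where

  length-filter+length-filter-∁ : ∀ xs →
                                  length (filter P? xs) + length (filter (∁? P?) xs) ≡ length xs
  length-filter+length-filter-∁ [] = refl
  length-filter+length-filter-∁ (x ∷ xs) with P? x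
  ... | yes _ = cong suc (length-filter+length-filter-∁ xs)
  ... | no _ = trans (ℕP.+-suc _ _) (cong suc (length-filter+length-filter-∁ xs))

module _ {a} {A : Set a} (f : A → ℚ) where

  argmax-∈ : ∀ xs → 0 < length xs → ∃ λ K → K ∈ xs × (∀ {x} → x ∈ xs → f x ℚ.≤ f K)
  argmax-∈ (y ∷ ys) _ =
    argmax f y ys , argmax-all f (here refl) (All.tabulate there) ,
    All.lookup (f[⊥]≤f[argmax] {f = f} y ys All.∷ f[xs]≤f[argmax] {f = f} y ys)

  threshold : ∀ {M} → 1 ≤ M → ∀ xs → M ≤ length xs →
              ∃ λ t → length (filter (λ x → f x ℚP.<? t) xs) < M ×
                      M ≤ length (filter (λ x → f x ℚP.≤? t) xs)
  threshold {M} 1≤M xs M≤∣xs∣ with argmax-∈ xs (ℕP.≤-trans 1≤M M≤∣xs∣)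
  ... | K , _ , ≤K = descend (f K) (<-wellFounded _)
        (subst (M ≤_) (cong length (sym (ListP.filter-all (λ x → f x ℚP.≤? f K) (All.tabulate ≤K))))
               M≤∣xs∣)
    where
    below : ℚ → List A
    below s = filter (λ x → f x ℚP.<? s) xs

    descend : ∀ s → Acc _<_ (length (below s)) → M ≤ length (filter (λ x → f x ℚP.≤? s) xs) →
              ∃ λ t → length (below t) < M × M ≤ length (filter (λ x → f x ℚP.≤? t) xs)
    descend s (acc rec) M≤ with length (below s) ℕP.<? M
    ... | yes few = s , few , M≤
    ... | no many with argmax-∈ (below s) (ℕP.≤-trans 1≤M (ℕP.≮⇒≥ many))
    ...   | K , K∈ , ≤K = descend (f K) (rec shorter) (ℕP.≤-trans (ℕP.≮⇒≥ many) wider)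
      where
      fK<s : f K ℚ.< s
      fK<s = proj₂ (∈-filter⁻ (λ x → f x ℚP.<? s) {xs = xs} K∈)
      shorter : length (below (f K)) < length (below s)
      shorter = length-filter-mono-< (λ x → f x ℚP.<? f K) (λ x → f x ℚP.<? s) {xs}
                  (λ _ fx<fK → ℚP.<-trans fx<fK fK<s)
                  (proj₁ (∈-filter⁻ (λ x → f x ℚP.<? s) {xs = xs} K∈)) fK<s (ℚP.<-irrefl refl)
      wider : length (below s) ≤ length (filter (λ x → f x ℚP.≤? f K) xs)
      wider = length-filter-mono (λ x → f x ℚP.<? s) (λ x → f x ℚP.≤? f K) {xs}
                (λ x∈xs fx<s → ≤K (∈-filter⁺ (λ x → f x ℚP.<? s) x∈xs fx<s))

treeSize : ℕ → ℕ → ℕ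
treeSize v zero = 1
treeSize v (suc d) = suc (suc v * treeSize v d)

1≤treeSize : ∀ v d → 1 ≤ treeSize v d
1≤treeSize v zero = s≤s z≤n
1≤treeSize v (suc d) = s≤s z≤n

module UpperBound {n} (I : Fin n → Interval) (v : ℕ) where

  open Stars I
  open import Data.List.Membership.DecPropositional (FinP._≟_ {n}) using (_∈?_)

  -- Colours are numbers below k rather than elements of Fin k, so that [] has a colouring with
  -- no colours at all.
  record Colouring (xs : List (Fin n)) (k : ℕ) : Set where
    field
      colour   : Fin n → ℕ
      colour<  : ∀ {u} → u ∈ xs → colour u < k
      starFree : ∀ j → StarFree I (λ u → u ∈ xs × colour u ≡ j) v

  Separated : List (Fin n) → List (Fin n) → Set
  Separated xs ys = ∀ {u w} → u ∈ xs → w ∈ ys → ¬ Meet (I u) (I w)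

  emptyColouring : Colouring [] 0
  emptyColouring = record { colour = λ _ → 0 ; colour< = λ () ; starFree = λ _ → noCentre }
    where
    noCentre : ∀ {S : Fin n → Set} → ¬ HasInducedStar I (λ u → u ∈ [] × S u) (suc v)
    noCentre (_ , _ , (() , _) , _)

  Colouring-⊆ : ∀ {xs ys k} → xs ⊆ ys → Colouring ys k → Colouring xs k
  Colouring-⊆ {xs} {ys} xs⊆ys c = record
    { colour = colour ; colour< = λ u∈xs → colour< (xs⊆ys u∈xs)
    ; starFree = λ j → starFree-⊆ (λ (u∈xs , ≡j) → xs⊆ys u∈xs , ≡j) (starFree j) }
    where open Colouring c

  piecewise : List (Fin n) → (Fin n → ℕ) → (Fin n → ℕ) → Fin n → ℕ
  piecewise xs f g u = if does (u ∈? xs) then f u else g u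

  piecewise-++ : ∀ {xs ys} f g {u} → u ∈ xs ++ ys →
                 (u ∈ xs × piecewise xs f g u ≡ f u) ⊎ (u ∈ ys × piecewise xs f g u ≡ g u)
  piecewise-++ {xs} f g {u} u∈ with u ∈? xs
  ... | yes u∈xs = inj₁ (u∈xs , refl)
  ... | no u∉xs with ∈-++⁻ xs u∈
  ...   | inj₁ u∈xs = contradiction u∈xs u∉xs
  ...   | inj₂ u∈ys = inj₂ (u∈ys , refl)

  glue : ∀ {xs ys k} → Separated xs ys → Colouring xs k → Colouring ys k → Colouring (xs ++ ys) k
  glue {xs} {ys} {k} sep cx cy = record { colour = colour ; colour< = colour< ; starFree = starFree }
    where
    module X = Colouring cx
    module Y = Colouring cy

    colour : Fin n → ℕ
    colour = piecewise xs X.colour Y.colour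

    side : ∀ {u} → u ∈ xs ++ ys →
           (u ∈ xs × colour u ≡ X.colour u) ⊎ (u ∈ ys × colour u ≡ Y.colour u)
    side = piecewise-++ X.colour Y.colour

    colour< : ∀ {u} → u ∈ xs ++ ys → colour u < k
    colour< u∈ with side u∈
    ... | inj₁ (u∈xs , eq) = subst (_< k) (sym eq) (X.colour< u∈xs)
    ... | inj₂ (u∈ys , eq) = subst (_< k) (sym eq) (Y.colour< u∈ys)

    starFree : ∀ j → StarFree I (λ u → u ∈ xs ++ ys × colour u ≡ j) v
    starFree j star@(c , _ , (c∈ , c≡j) , _) with side c∈
    ... | inj₁ (c∈xs , eq) = X.starFree j (restrictStar star (c∈xs , trans (sym eq) c≡j) toX)
      where
      toX : ∀ {u} → u ∈ xs ++ ys × colour u ≡ j → Meet (I c) (I u) → u ∈ xs × X.colour u ≡ j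
      toX (u∈ , u≡j) meet with side u∈
      ... | inj₁ (u∈xs , eq) = u∈xs , trans (sym eq) u≡j
      ... | inj₂ (u∈ys , _) = contradiction meet (sep c∈xs u∈ys)
    ... | inj₂ (c∈ys , eq) = Y.starFree j (restrictStar star (c∈ys , trans (sym eq) c≡j) toY)
      where
      toY : ∀ {u} → u ∈ xs ++ ys × colour u ≡ j → Meet (I c) (I u) → u ∈ ys × Y.colour u ≡ j
      toY {u} (u∈ , u≡j) meet with side u∈
      ... | inj₁ (u∈xs , _) = contradiction (Meet-sym {I c} {I u} meet) (sep u∈xs c∈ys)
      ... | inj₂ (u∈ys , eq) = u∈ys , trans (sym eq) u≡j

  addClass : ∀ {xs ys k} → StarFree I (_∈ xs) v → Colouring ys k → Colouring (xs ++ ys) (suc k)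
  addClass {xs} {ys} {k} xsFree cy = record { colour = colour ; colour< = colour< ; starFree = starFree }
    where
    module Y = Colouring cy

    colour : Fin n → ℕ
    colour = piecewise xs (λ _ → 0) (suc ∘ Y.colour)

    side : ∀ {u} → u ∈ xs ++ ys →
           (u ∈ xs × colour u ≡ 0) ⊎ (u ∈ ys × colour u ≡ suc (Y.colour u))
    side = piecewise-++ (λ _ → 0) (suc ∘ Y.colour)

    colour< : ∀ {u} → u ∈ xs ++ ys → colour u < suc k
    colour< u∈ with side u∈
    ... | inj₁ (_ , eq) = subst (_< suc k) (sym eq) (s≤s z≤n)
    ... | inj₂ (u∈ys , eq) = subst (_< suc k) (sym eq) (s≤s (Y.colour< u∈ys))

    newClass : ∀ {u} → u ∈ xs ++ ys × colour u ≡ 0 → u ∈ xs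
    newClass (u∈ , u≡0) with side u∈
    ... | inj₁ (u∈xs , _) = u∈xs
    ... | inj₂ (_ , eq) = contradiction (trans (sym eq) u≡0) λ ()

    oldClass : ∀ {u j} → u ∈ xs ++ ys × colour u ≡ suc j → u ∈ ys × Y.colour u ≡ j
    oldClass (u∈ , u≡j) with side u∈
    ... | inj₁ (_ , eq) = contradiction (trans (sym eq) u≡j) λ ()
    ... | inj₂ (u∈ys , eq) = u∈ys , ℕP.suc-injective (trans (sym eq) u≡j)

    starFree : ∀ j → StarFree I (λ u → u ∈ xs ++ ys × colour u ≡ j) v
    starFree zero = starFree-⊆ newClass xsFree
    starFree (suc j) = starFree-⊆ oldClass (Y.starFree j)

  ℓ ρ : Fin n → ℚ
  ℓ u = left (I u)
  ρ u = right (I u)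

  endingBefore endingBy startingBefore startingFrom : ℚ → List (Fin n) → List (Fin n)
  endingBefore   t = filter (λ u → ρ u ℚP.<? t)
  endingBy       t = filter (λ u → ρ u ℚP.≤? t)
  startingBefore t = filter (λ u → ℓ u ℚP.<? t)
  startingFrom   t = filter (∁? (λ u → ℓ u ℚP.<? t))

  across : ℚ → List (Fin n) → List (Fin n)
  across t = filter (λ u → ℓ u ℚP.<? t ×-dec t ℚP.≤? ρ u)

  module _ (t : ℚ) (xs : List (Fin n)) where

    endingBefore⁻ : ∀ {u} → u ∈ endingBefore t xs → ρ u ℚ.< t
    endingBefore⁻ = proj₂ ∘ ∈-filter⁻ (λ u → ρ u ℚP.<? t) {xs = xs}

    across⁻ : ∀ {u} → u ∈ across t xs → ℓ u ℚ.< t × t ℚ.≤ ρ u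
    across⁻ = proj₂ ∘ ∈-filter⁻ (λ u → ℓ u ℚP.<? t ×-dec t ℚP.≤? ρ u) {xs = xs}

    startingFrom⁻ : ∀ {u} → u ∈ startingFrom t xs → t ℚ.≤ ℓ u
    startingFrom⁻ = ℚP.≮⇒≥ ∘ proj₂ ∘ ∈-filter⁻ (∁? (λ u → ℓ u ℚP.<? t)) {xs = xs}

    ∈-split : ∀ {u} → u ∈ xs → u ∈ endingBefore t xs ⊎ u ∈ across t xs ⊎ u ∈ startingFrom t xs
    ∈-split {u} u∈xs with ρ u ℚP.<? t | ℓ u ℚP.<? t
    ... | yes ρu<t | _ = inj₁ (∈-filter⁺ (λ u → ρ u ℚP.<? t) u∈xs ρu<t)
    ... | no ρu≮t | yes ℓu<t =
      inj₂ (inj₁ (∈-filter⁺ (λ u → ℓ u ℚP.<? t ×-dec t ℚP.≤? ρ u) u∈xs (ℓu<t , ℚP.≮⇒≥ ρu≮t)))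
    ... | no _ | no ℓu≮t = inj₂ (inj₂ (∈-filter⁺ (∁? (λ u → ℓ u ℚP.<? t)) u∈xs ℓu≮t))

    across-clique : ∀ {u w} → u ∈ across t xs → w ∈ across t xs → Meet (I u) (I w)
    across-clique u∈ w∈ =
      overlap⇒Meet {I _} {I _} (ℚP.<-≤-trans (proj₁ (across⁻ u∈)) (proj₂ (across⁻ w∈)))
                               (ℚP.<-≤-trans (proj₁ (across⁻ w∈)) (proj₂ (across⁻ u∈)))

    startingBefore+startingFrom : length (startingBefore t xs) + length (startingFrom t xs) ≡ length xs
    startingBefore+startingFrom = length-filter+length-filter-∁ (λ u → ℓ u ℚP.<? t) xs

    endingBy≤startingBefore : length (endingBy t xs) ≤ length (startingBefore t xs)
    endingBy≤startingBefore = length-filter-mono (λ u → ρ u ℚP.≤? t) (λ u → ℓ u ℚP.<? t) {xs}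
      (λ {u} _ ρu≤t → ℚP.<-≤-trans (nonempty (I u)) ρu≤t)

  module Sweeping {k M} (1≤M : 1 ≤ M) (colourSmall : ∀ {xs} → length xs < M → Colouring xs k) where

    record Sweep (xs : List (Fin n)) : Set where
      field
        cliques rest   : List (Fin n)
        cliques⊆xs     : cliques ⊆ xs
        rest⊆xs        : rest ⊆ xs
        xs⊆            : xs ⊆ cliques ++ rest
        restColouring  : Colouring rest k
        count          : ℕ
        index          : Fin n → ℕ
        index<count    : ∀ {u} → u ∈ cliques → index u < count
        clique         : ∀ {u w} → u ∈ cliques → w ∈ cliques → index u ≡ index w → Meet (I u) (I w)
        count*M≤       : count * M ≤ length xs
        slack⊎clusters : count * M < length xs ⊎
                         (∀ {u w} → u ∈ cliques → w ∈ cliques → Meet (I u) (I w) → index u ≡ index w)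

    stop : ∀ {xs} → length xs < M → Sweep xs
    stop small = record
      { cliques = [] ; rest = _ ; cliques⊆xs = λ () ; rest⊆xs = λ u∈ → u∈ ; xs⊆ = λ u∈ → u∈
      ; restColouring = colourSmall small ; count = 0 ; index = λ _ → 0 ; index<count = λ ()
      ; clique = λ () ; count*M≤ = z≤n ; slack⊎clusters = inj₂ λ () }

    module Cut {xs} (t : ℚ) (few : length (endingBefore t xs) < M)
               (enough : M ≤ length (endingBy t xs)) (sweep′ : Sweep (startingFrom t xs)) where

      module S = Sweep sweep′ renaming (cliques⊆xs to cliques⊆R; rest⊆xs to rest⊆R)

      cliques rest : List (Fin n)
      cliques = across t xs ++ S.cliques
      rest    = endingBefore t xs ++ S.rest

      xs⊆ : xs ⊆ cliques ++ rest
      xs⊆ u∈xs with ∈-split t xs u∈xs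
      ... | inj₁ u∈G = ∈-++⁺ʳ cliques (∈-++⁺ˡ u∈G)
      ... | inj₂ (inj₁ u∈C) = ∈-++⁺ˡ (∈-++⁺ˡ u∈C)
      ... | inj₂ (inj₂ u∈R) with ∈-++⁻ S.cliques (S.xs⊆ u∈R)
      ...   | inj₁ u∈S = ∈-++⁺ˡ (∈-++⁺ʳ (across t xs) u∈S)
      ...   | inj₂ u∈rest = ∈-++⁺ʳ cliques (∈-++⁺ʳ (endingBefore t xs) u∈rest)

      separated : Separated (endingBefore t xs) S.rest
      separated u∈ w∈ = right≤left⇒¬Meet {I _} {I _}
        (ℚP.<⇒≤ (ℚP.<-≤-trans (endingBefore⁻ t xs u∈) (startingFrom⁻ t xs (S.rest⊆R w∈))))

      index : Fin n → ℕ
      index = piecewise (across t xs) (λ _ → S.count) S.index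

      side : ∀ {u} → u ∈ cliques →
             (u ∈ across t xs × index u ≡ S.count) ⊎ (u ∈ S.cliques × index u ≡ S.index u)
      side = piecewise-++ (λ _ → S.count) S.index

      index<count : ∀ {u} → u ∈ cliques → index u < suc S.count
      index<count u∈ with side u∈
      ... | inj₁ (_ , eq) = subst (_< suc S.count) (sym eq) (ℕP.n<1+n S.count)
      ... | inj₂ (u∈S , eq) = subst (_< suc S.count) (sym eq) (ℕP.m<n⇒m<1+n (S.index<count u∈S))

      clique : ∀ {u w} → u ∈ cliques → w ∈ cliques → index u ≡ index w → Meet (I u) (I w)
      clique u∈ w∈ same with side u∈ | side w∈
      ... | inj₁ (u∈C , _) | inj₁ (w∈C , _) = across-clique t xs u∈C w∈C
      ... | inj₁ (_ , eq) | inj₂ (w∈S , eq′) =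
        contradiction (trans (sym eq) (trans same eq′)) (ℕP.<⇒≢ (S.index<count w∈S) ∘ sym)
      ... | inj₂ (u∈S , eq) | inj₁ (_ , eq′) =
        contradiction (trans (sym eq) (trans same eq′)) (ℕP.<⇒≢ (S.index<count u∈S))
      ... | inj₂ (u∈S , eq) | inj₂ (w∈S , eq′) = S.clique u∈S w∈S (trans (sym eq) (trans same eq′))

      Straddles : Fin n → Set
      Straddles u = ℓ u ℚ.< t × t ℚ.< ρ u

      M≤removed : M ≤ length (startingBefore t xs)
      M≤removed = ℕP.≤-trans enough (endingBy≤startingBefore t xs)

      M<removed : Any Straddles xs → M < length (startingBefore t xs)
      M<removed straddling with find straddling
      ... | u , u∈xs , ℓu<t , t<ρu = ℕP.≤-<-trans enough
        (length-filter-mono-< (λ u → ρ u ℚP.≤? t) (λ u → ℓ u ℚP.<? t) {xs}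
           (λ {u} _ ρu≤t → ℚP.<-≤-trans (nonempty (I u)) ρu≤t) u∈xs ℓu<t
           (λ ρu≤t → ℚP.<-irrefl refl (ℚP.<-≤-trans t<ρu ρu≤t)))

      tight-apart : ¬ Any Straddles xs →
                    ∀ {u w} → u ∈ across t xs → w ∈ S.cliques → ¬ Meet (I u) (I w)
      tight-apart noStraddling {u} u∈C w∈S = right≤left⇒¬Meet {I _} {I _}
        (ℚP.≤-trans ρu≤t (startingFrom⁻ t xs (S.cliques⊆R w∈S)))
        where
        ρu≤t : ρ u ℚ.≤ t
        ρu≤t = ℚP.≮⇒≥ λ t<ρu →
          noStraddling (lose (filter-⊆ _ xs u∈C) (proj₁ (across⁻ t xs u∈C) , t<ρu))

      tight-clusters : ¬ Any Straddles xs →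
                       (∀ {u w} → u ∈ S.cliques → w ∈ S.cliques →
                          Meet (I u) (I w) → S.index u ≡ S.index w) →
                       ∀ {u w} → u ∈ cliques → w ∈ cliques → Meet (I u) (I w) → index u ≡ index w
      tight-clusters noStraddling clusters {u} {w} u∈ w∈ meet with side u∈ | side w∈
      ... | inj₁ (_ , eq) | inj₁ (_ , eq′) = trans eq (sym eq′)
      ... | inj₁ (u∈C , _) | inj₂ (w∈S , _) = contradiction meet (tight-apart noStraddling u∈C w∈S)
      ... | inj₂ (u∈S , _) | inj₁ (w∈C , _) =
        contradiction (Meet-sym {I u} {I w} meet) (tight-apart noStraddling w∈C u∈S)
      ... | inj₂ (u∈S , eq) | inj₂ (w∈S , eq′) = trans eq (trans (clusters u∈S w∈S meet) (sym eq′))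

      slack⊎clusters : suc S.count * M < length xs ⊎
                       (∀ {u w} → u ∈ cliques → w ∈ cliques → Meet (I u) (I w) → index u ≡ index w)
      slack⊎clusters with any? (λ u → ℓ u ℚP.<? t ×-dec t ℚP.<? ρ u) xs | S.slack⊎clusters
      ... | yes straddling | _ = inj₁ (subst (suc S.count * M <_) (startingBefore+startingFrom t xs)
                                        (ℕP.+-mono-<-≤ (M<removed straddling) S.count*M≤))
      ... | no _ | inj₁ slack = inj₁ (subst (suc S.count * M <_) (startingBefore+startingFrom t xs)
                                      (ℕP.+-mono-≤-< M≤removed slack))
      ... | no noStraddling | inj₂ clusters = inj₂ (tight-clusters noStraddling clusters)

      result : Sweep xs
      result = record
        { cliques = cliques ; rest = rest
        ; cliques⊆xs = [ filter-⊆ _ xs , filter-⊆ _ xs ∘ S.cliques⊆R ]′ ∘ ∈-++⁻ (across t xs)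
        ; rest⊆xs = [ filter-⊆ _ xs , filter-⊆ _ xs ∘ S.rest⊆R ]′ ∘ ∈-++⁻ (endingBefore t xs)
        ; xs⊆ = xs⊆
        ; restColouring = glue separated (colourSmall few) S.restColouring
        ; count = suc S.count ; index = index ; index<count = index<count ; clique = clique
        ; count*M≤ = subst (suc S.count * M ≤_) (startingBefore+startingFrom t xs)
                       (ℕP.+-mono-≤ M≤removed S.count*M≤)
        ; slack⊎clusters = slack⊎clusters
        }

    sweep : ∀ xs → Acc _<_ (length xs) → Sweep xs
    sweep xs (acc rec) with length xs ℕP.<? M
    ... | yes small = stop small
    ... | no big with threshold ρ 1≤M xs (ℕP.≮⇒≥ big)
    ...   | t , few , enough = Cut.result t few enough (sweep (startingFrom t xs) (rec shorter))
      where
      shorter : length (startingFrom t xs) < length xs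
      shorter = subst (length (startingFrom t xs) <_) (startingBefore+startingFrom t xs)
                  (ℕP.m<n+m _ (ℕP.≤-trans 1≤M (ℕP.≤-trans enough (endingBy≤startingBefore t xs))))

    cliquesStarFree : 1 ≤ v → ∀ {xs} (S : Sweep xs) → length xs ≤ suc v * M →
                      StarFree I (_∈ Sweep.cliques S) v
    cliquesStarFree 1≤v {xs} S ∣xs∣≤ =
      [ fewCliques , clusters⇒starFree index 1≤v clique ]′ slack⊎clusters
      where
      open Sweep S
      fewCliques : count * M < length xs → StarFree I (_∈ cliques) v
      fewCliques slack = fewCliques⇒starFree index (λ u∈ → ℕP.<-≤-trans (index<count u∈) count≤v) clique
        where
        count≤v : count ≤ v
        count≤v = ℕP.≤-pred (ℕP.*-cancelʳ-< M count (suc v) (ℕP.<-≤-trans slack ∣xs∣≤))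

  colouring : 1 ≤ v → ∀ k xs → length xs < treeSize v k → Colouring xs k
  colouring _ zero [] _ = emptyColouring
  colouring _ zero (_ ∷ _) (s≤s ())
  colouring 1≤v (suc k) xs (s≤s ∣xs∣≤) =
    Colouring-⊆ xs⊆ (addClass (cliquesStarFree 1≤v S ∣xs∣≤) restColouring)
    where
    open Sweeping (1≤treeSize v k) (colouring 1≤v k _)
    S : Sweep xs
    S = sweep xs (<-wellFounded _)
    open Sweep S

  partition : 1 ≤ v → ∀ k → n < treeSize v k →
              Σ (Fin n → Fin k) λ part → ∀ j → ClawNumberAtMost I (λ u → part u ≡ j) v
  partition 1≤v k n< =
    part , λ j → starFree⇒clawNumberAtMost (starFree-⊆ (inClass j) (starFree (Fin.toℕ j)))
    where
    open Colouring (colouring 1≤v k (allFin n)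
                      (subst (_< treeSize v k) (sym (ListP.length-tabulate id)) n<))
    part : Fin n → Fin k
    part u = Fin.fromℕ< (colour< (∈-allFin u))
    inClass : ∀ j {u} → part u ≡ j → u ∈ allFin n × colour u ≡ Fin.toℕ j
    inClass _ {u} refl = ∈-allFin u , sym (FinP.toℕ-fromℕ< _)

module LowerBound (v : ℕ) where

  data Node : ℕ → Set where
    root  : ∀ {d} → Node d
    child : ∀ {d} → Fin (suc v) → Node d → Node (suc d)

  encode : ∀ {d} → Node d → Fin (treeSize v d)
  encode {zero}  root        = Fin.zero
  encode {suc d} root        = Fin.zero
  encode {suc d} (child i y) = Fin.suc (Fin.combine i (encode y))

  decode : ∀ {d} → Fin (treeSize v d) → Node d
  decode {zero}  _           = root
  decode {suc d} Fin.zero    = root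
  decode {suc d} (Fin.suc z) = uncurry (λ i w → child i (decode w)) (Fin.remQuot (treeSize v d) z)

  decode-encode : ∀ {d} (y : Node d) → decode (encode y) ≡ y
  decode-encode {zero}  root        = refl
  decode-encode {suc d} root        = refl
  decode-encode {suc d} (child i y) =
    trans (cong (uncurry λ i w → child i (decode w)) (FinP.remQuot-combine i (encode y)))
          (cong (child i) (decode-encode y))

  exists? : ∀ {d} {P : Node d → Set} → Decidable P → Dec (∃ P)
  exists? {P = P} P? with FinP.any? (P? ∘ decode)
  ... | yes (z , p) = yes (decode z , p)
  ... | no ¬p = no λ (y , py) → ¬p (encode y , subst P (sym (decode-encode y)) py)

  SubtreeAvoiding : ∀ d {j} → (Node d → Fin j) → Set
  SubtreeAvoiding zero    col = ⊤
  SubtreeAvoiding (suc d) col = ¬ (∀ i → ∃ λ y → col (child i y) ≡ col root) ×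
                                (∀ i → SubtreeAvoiding d (col ∘ child i))

  SubtreeAvoiding-refine : ∀ d {j j′} {col : Node d → Fin j} (col′ : Node d → Fin j′) →
                           (∀ x y → col′ x ≡ col′ y → col x ≡ col y) →
                           SubtreeAvoiding d col → SubtreeAvoiding d col′
  SubtreeAvoiding-refine zero    _    _      _                = tt
  SubtreeAvoiding-refine (suc d) col′ coarse (notAll , below) =
    (λ all → notAll λ i → proj₁ (all i) , coarse _ _ (proj₂ (all i))) ,
    (λ i → SubtreeAvoiding-refine d (col′ ∘ child i) (λ x y → coarse (child i x) (child i y)) (below i))

  subtreeAvoiding⇒depth< : ∀ d {j} (col : Node d → Fin j) → SubtreeAvoiding d col → d < j
  subtreeAvoiding⇒depth< d       {zero}  col _ with col root
  ... | ()
  subtreeAvoiding⇒depth< zero    {suc j} _   _ = s≤s z≤n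
  subtreeAvoiding⇒depth< (suc d) {suc j} col (notAll , below)
    with FinP.¬∀⟶∃¬ (suc v) _ (λ i → exists? (λ y → col (child i y) FinP.≟ col root)) notAll
  ... | i , avoids = s≤s (subtreeAvoiding⇒depth< d col′
                       (SubtreeAvoiding-refine d col′ (λ _ _ → FinP.punchOut-injective {i = col root} _ _)
                          (below i)))
    where
    col′ : Node d → Fin j
    col′ y = Fin.punchOut {i = col root} (λ eq → avoids (y , sym eq))

  width : ℕ → ℕ
  width d = suc v ^ d

  -- The tree drawn from offset o: the children of a node of depth d + 1 occupy consecutive
  -- blocks of width (v+1)^d inside its segment.
  lo hi : ∀ {d} → ℕ → Node d → ℕ
  lo         o root        = o
  lo {suc d} o (child i y) = lo (o + Fin.toℕ i * width d) y
  hi {d}     o root        = o + width d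
  hi {suc d} o (child i y) = hi (o + Fin.toℕ i * width d) y

  o+a*w+w≤o+b*w : ∀ o w {a b} → a < b → o + a * w + w ≤ o + b * w
  o+a*w+w≤o+b*w o w {a} {b} a<b = begin
    o + a * w + w   ≡⟨ ℕP.+-assoc o (a * w) w ⟩
    o + (a * w + w) ≡⟨ cong (o +_) (ℕP.+-comm (a * w) w) ⟩
    o + suc a * w   ≤⟨ ℕP.+-monoʳ-≤ o (ℕP.*-monoˡ-≤ w a<b) ⟩
    o + b * w       ∎
    where open ℕP.≤-Reasoning

  bounds : ∀ {d} o (y : Node d) → o ≤ lo o y × lo o y < hi o y × hi o y ≤ o + width d
  bounds {d} o root = ℕP.≤-refl , ℕP.m<m+n o (ℕP.m^n>0 (suc v) d) , ℕP.≤-refl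
  bounds {suc d} o (child i y) with bounds (o + Fin.toℕ i * width d) y
  ... | o′≤lo , lo<hi , hi≤ =
    ℕP.≤-trans (ℕP.m≤m+n o _) o′≤lo , lo<hi ,
    ℕP.≤-trans hi≤ (o+a*w+w≤o+b*w o (width d) (FinP.toℕ<n i))

  segment : ∀ {d} → ℕ → Node d → Interval
  segment o y = interval (toℚ (lo o y)) (toℚ (hi o y)) (toℚ-mono-< (proj₁ (proj₂ (bounds o y))))

  root-meets-child : ∀ {d} o i (y : Node d) → Meet (segment o (root {suc d})) (segment o (child i y))
  root-meets-child {d} o i y with bounds (o + Fin.toℕ i * width d) y
  ... | o′≤lo , lo<hi , hi≤ = overlap⇒Meet {segment o (root {suc d})} {segment o (child i y)}
    (toℚ-mono-< (ℕP.≤-<-trans (ℕP.≤-trans (ℕP.m≤m+n o _) o′≤lo) lo<hi))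
    (toℚ-mono-< (ℕP.<-≤-trans lo<hi (ℕP.≤-trans hi≤ (o+a*w+w≤o+b*w o (width d) (FinP.toℕ<n i)))))

  children-apart : ∀ {d} o {i i′ : Fin (suc v)} (y y′ : Node d) → i Fin.< i′ →
                   ¬ Meet (segment o (child i y)) (segment o (child i′ y′))
  children-apart {d} o {i} {i′} y y′ i<i′ =
    right≤left⇒¬Meet {segment o (child i y)} {segment o (child i′ y′)} (toℚ-mono-≤
      (ℕP.≤-trans (proj₂ (proj₂ (bounds (o + Fin.toℕ i * width d) y)))
        (ℕP.≤-trans (o+a*w+w≤o+b*w o (width d) i<i′) (proj₁ (bounds (o + Fin.toℕ i′ * width d) y′)))))

  children-disjoint : ∀ {d} o {i i′ : Fin (suc v)} (y y′ : Node d) → i ≢ i′ →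
                      ¬ Meet (segment o (child i y)) (segment o (child i′ y′))
  children-disjoint o {i} {i′} y y′ i≢i′ with FinP.<-cmp i i′
  ... | tri< i<i′ _ _ = children-apart o y y′ i<i′
  ... | tri≈ _ i≡i′ _ = contradiction i≡i′ i≢i′
  ... | tri> _ _ i′<i =
    children-apart o y′ y i′<i ∘ Meet-sym {segment o (child i y)} {segment o (child i′ y′)}

  module _ {n} (I : Fin n → Interval) {j} (part : Fin n → Fin j)
           (classFree : ∀ c → StarFree I (λ u → part u ≡ c) v) where

    subtreeAvoiding : ∀ d o (node : Node d → Fin n) → Injective _≡_ _≡_ node →
                      (∀ y → I (node y) ≡ segment o y) → SubtreeAvoiding d (part ∘ node)
    subtreeAvoiding zero    _ _    _        _      = tt
    subtreeAvoiding (suc d) o node node-inj I∘node =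
      (λ all → classFree _ (star all)) ,
      (λ i → subtreeAvoiding d (o + Fin.toℕ i * width d) (node ∘ child i)
               (λ eq → child-injectiveʳ (node-inj eq)) (I∘node ∘ child i))
      where
      child-injectiveʳ : ∀ {i} {y y′ : Node d} → child i y ≡ child i y′ → y ≡ y′
      child-injectiveʳ refl = refl

      child-injectiveˡ : ∀ {i i′} {y y′ : Node d} → child i y ≡ child i′ y′ → i ≡ i′
      child-injectiveˡ refl = refl

      star : (∀ i → ∃ λ y → part (node (child i y)) ≡ part (node root)) →
             HasInducedStar I (λ u → part u ≡ part (node root)) (suc v)
      star all = node root , leaf , refl , child-injectiveˡ ∘ node-inj , proj₂ ∘ all ,
                 (λ i → (λ eq → root≢child (node-inj eq)) ,
                        subst₂ Meet (sym (I∘node root)) (sym (I∘node (child i (y i))))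
                                    (root-meets-child o i (y i))) ,
                 (λ i i′ i≢i′ (_ , meet) → children-disjoint o (y i) (y i′) i≢i′
                    (subst₂ Meet (I∘node (child i (y i))) (I∘node (child i′ (y i′))) meet))
        where
        y : Fin (suc v) → Node d
        y i = proj₁ (all i)
        leaf : Fin (suc v) → Fin n
        leaf i = node (child i (y i))
        root≢child : ∀ {i} {y : Node d} → root ≢ child i y
        root≢child ()

  lowerBound : ∀ {n D j} → treeSize v D ≤ n → Partitionable n v j → D < j
  lowerBound {n} {D} {j} N≤n partitionable =
    subtreeAvoiding⇒depth< D (part ∘ node)
      (subtreeAvoiding I part (λ c → Stars.clawNumberAtMost⇒starFree I (atMost c)) D 0 node node-inj
         (λ y → cong (segment 0) (position-node y)))
    where
    node : Node D → Fin n
    node y = Fin.inject≤ (encode y) N≤n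

    position : Fin n → Node D
    position u with Fin.toℕ u ℕP.<? treeSize v D
    ... | yes u<N = decode (Fin.fromℕ< u<N)
    ... | no _ = root

    toℕ-node : ∀ y → Fin.toℕ (node y) ≡ Fin.toℕ (encode y)
    toℕ-node y = FinP.toℕ-inject≤ (encode y) N≤n

    position-node : ∀ y → position (node y) ≡ y
    position-node y with Fin.toℕ (node y) ℕP.<? treeSize v D
    ... | yes p = trans (cong decode (FinP.toℕ-injective (trans (FinP.toℕ-fromℕ< p) (toℕ-node y))))
                        (decode-encode y)
    ... | no ¬p = contradiction (subst (_< treeSize v D) (sym (toℕ-node y)) (FinP.toℕ<n (encode y))) ¬p

    node-inj : Injective _≡_ _≡_ node
    node-inj {x} {y} eq = trans (sym (position-node x)) (trans (cong position eq) (position-node y))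

    I : Fin n → Interval
    I = segment 0 ∘ position

    part : Fin n → Fin j
    part = proj₁ (partitionable I)

    atMost : ∀ c → ClawNumberAtMost I (λ u → part u ≡ c) v
    atMost = proj₂ (partitionable I)

treeSize-geometric : ∀ v d → treeSize v d * v + 1 ≡ suc v ^ suc d
treeSize-geometric v zero = base v
  where
  base : ∀ v → 1 * v + 1 ≡ suc v * 1
  base = solve-∀
treeSize-geometric v (suc d) = begin
  suc (suc v * treeSize v d) * v + 1 ≡⟨ step v (treeSize v d) ⟩
  suc v * (treeSize v d * v + 1)     ≡⟨ cong (suc v *_) (treeSize-geometric v d) ⟩
  suc v * suc v ^ suc d              ∎
  where
  open ≡-Reasoning
  step : ∀ v N → suc (suc v * N) * v + 1 ≡ suc v * (N * v + 1)
  step = solve-∀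

<treeSize : ∀ {n v k} → n * v + 1 < suc v ^ suc k → n < treeSize v k
<treeSize {n} {v} {k} bound = ℕP.*-cancelʳ-< v n (treeSize v k)
  (ℕP.+-cancelʳ-< 1 (n * v) _ (subst (n * v + 1 <_) (sym (treeSize-geometric v k)) bound))

treeSize≤ : ∀ {n v k} → 1 ≤ v → suc v ^ suc k ≤ n * v + 1 → treeSize v k ≤ n
treeSize≤ {n} {v} {k} 1≤v bound = ℕP.*-cancelʳ-≤ (treeSize v k) n v {{ℕ.>-nonZero 1≤v}}
  (ℕP.+-cancelʳ-≤ 1 _ _ (subst (_≤ n * v + 1) (sym (treeSize-geometric v k)) bound))

upperBound : ∀ {n v} k → 1 ≤ v → n < treeSize v k → Partitionable n v k
upperBound k 1≤v n<N I = UpperBound.partition I _ 1≤v k n<N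

floorLog≤ : ∀ {n v j} L → 1 ≤ v → suc v ^ L ≤ n * v + 1 → Partitionable n v j → L ≤ j
floorLog≤ zero    _   _     _ = z≤n
floorLog≤ (suc D) 1≤v bound P = LowerBound.lowerBound _ (treeSize≤ 1≤v bound) P

corollary1 : (n v L : ℕ) → 1 ≤ n → 1 ≤ v →
    IsFloorLog (v + 1) (n * v + 1) L → IsKappa n v L
corollary1 n v L _ 1≤v floorLog rewrite ℕP.+-comm v 1 =
  upperBound L 1≤v (<treeSize (proj₂ floorLog)) , λ j → floorLog≤ L 1≤v (proj₁ floorLog)
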